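{- Let $n\ge1$, $h\ge1$, $0\le\bar w\le n$, let $H$ be a multiset of $h$ binary strings each of length $n$ and weight $\bar w$, let $M=M(H)$, and let $f$ be a cumulative weight function that is a solution to $M$ and satisfies conditions (C1) and (C2). If the functions $f_m$, $m\in A(\bar w/2)$, are all the same, then there are no branching points in $\mathcal{G}(f_m,[\lfloor n/2\rfloor])$ for all $m\in A(\bar w/2)$.
   Context: Notation: $[n]=\{1,\dots,n\}$; $[n_1,n_2]=\{n_1,\dots,n_2\}$ if $n_1\le n_2$, else $\emptyset$. For a binary string $t$ of length $n$, $\mathrm{wt}(t)$ is its number of ones, $t[l]$, $t[-l]$ its length-$l$ prefix and suffix; $M(t)$ is the multiset union of $\{(j-\mathrm{wt}(t[j]),\mathrm{wt}(t[j])) : j\in[n]\}$ and $\{(j-\mathrm{wt}(t[-j]),\mathrm{wt}(t[-j])) : j\in[n]\}$, and $M(H)$ is the multiset union of $M(t)$, $t\in H$. A cumulative weight function (CWF) is $f:\{0,\dots,n\}\times[2h]\to\{0,\dots,n\}$ with (a) $f(0,m)=0$; (b) $f(l,m)-f(l-1,m)\in\{0,1\}$ for $(l,m)\in[n]\times[2h]$; (c) for each $j\in[h]$ there is $w_j$ with $f(l,2j-1)+f(n-l,2j)=w_j$ for all $l\in\{0,\dots,n\}$. Write $f_m(l)=f(l,m)$; $m^*=m-1$ if $m$ is even, $m^*=m+1$ if $m$ is odd. $f$ is a solution to $M$ if $M=\{(l-f_m(l),f_m(l)): m\in[2h],l\in[n]\}$ as multisets. $D(m_1,m_2)=\{l\in[n]:f_{m_1}(l)\ne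 f_{m_2}(l)\}$; a nonempty $[k_1,k_2]\subset[n]$ is a maximal interval between $f_{m_1}$ and $f_{m_2}$ if $[k_1,k_2]\subset D(m_1,m_2)$ and $k_1-1,k_2+1\notin D(m_1,m_2)$. Condition (C1): for any $m_1,m_2\in[2h]$ with $m_1^*=m_2$ there are at most two maximal intervals between $f_{m_1}$ and $f_{m_2}$. Condition (C2): for any $m_1,m_2\in[2h]$ with $m_1^*\ne m_2$ there is at most one maximal interval between $f_{m_1}$ and $f_{m_2}$. $\mathrm{med}(f_m)=\frac12(f_m(\lfloor n/2\rfloor)+f_m(\lceil n/2\rceil))$ and $A(w)=\{m\in[2h]:\mathrm{med}(f_m)=w\}$. For $I\subset\{0,\dots,n\}$, $\mathcal{G}(f_m,I)=\{(l,f_m(l)):l\in I\}$. With $A(l,w)=\{m\in[2h]:f_m(l)=w\}$, set for $(l,w)\in[n]^2$: $b_{l,w}=|A(l,w)\cap A(l-1,w)|$, $c_{l,w}=|A(l,w)\cap A(l-1,w-1)|$, and $b_{l,0}=|A(l,0)|$, $c_{l,0}=0$ for $l\in[n]$. A point $(l,w)\in\{0,\dots,n\}^2$ is a branching point if $b_{l,w}>0$ and $c_{l,w}>0$. -}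

module Defs where

open import Data.Nat using (ℕ; zero; suc; _+_; _*_; _∸_; _≤_; _<_; ⌊_/2⌋; ⌈_/2⌉)
open import Data.Nat.Properties using (_≟_)
open import Data.Bool using (Bool; true; false)
open import Data.Fin using (Fin; toℕ)
open import Data.Vec using (Vec; toList)
open import Data.List using (List; []; _∷_; map; concatMap; take; drop; length; filter; upTo; allFin; _++_)
open import Data.Product using (_×_; _,_; ∃)
open import Data.Sum using (_⊎_)
open import Relation.Nullary using (¬_)
open import Relation.Nullary.Decidable using (_×-dec_)
open import Relation.Binary.PropositionalEquality using (_≡_; _≢_)
open import Data.List.Relation.Binary.Permutation.Propositional using (_↭_)

wtL : List Bool → ℕ
wtL []           = 0
wtL (true  ∷ bs) = suc (wtL bs)
wtL (false ∷ bs) = wtL bs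

wt : ∀ {n} → Vec Bool n → ℕ
wt t = wtL (toList t)

wtPre : ∀ {n} → Vec Bool n → ℕ → ℕ
wtPre t j = wtL (take j (toList t))

wtSuf : ∀ {n} → Vec Bool n → ℕ → ℕ
wtSuf {n} t j = wtL (drop (n ∸ j) (toList t))

range : ℕ → List ℕ
range n = map suc (upTo n)

-- M(t), as a list (multiset up to permutation)
Mstr : ∀ {n} → Vec Bool n → List (ℕ × ℕ)
Mstr {n} t =
  map (λ j → (j ∸ wtPre t j , wtPre t j)) (range n) ++
  map (λ j → (j ∸ wtSuf t j , wtSuf t j)) (range n)

-- M(H) for a multiset H of h strings, given as a family indexed by Fin h
MH : ∀ {n h} → (Fin h → Vec Bool n) → List (ℕ × ℕ)
MH {h = h} H = concatMap (λ i → Mstr (H i)) (allFin h)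

-- Cumulative weight functions.
-- The index m ∈ [2h] of the paper is represented 0-based by k : Fin (2 * h)
-- (paper m = toℕ k + 1).  f k l is f(l, m); only l ≤ n is meaningful.

CWF : (n h : ℕ) → Set
CWF n h = Fin (2 * h) → ℕ → ℕ

-- m* on 0-based indices: paper m odd  (k even) ↦ m+1 (k+1);
--                         paper m even (k odd)  ↦ m-1 (k-1).
star : ℕ → ℕ
star zero          = 1
star (suc zero)    = 0
star (suc (suc k)) = suc (suc (star k))

IsCWF : (n h : ℕ) → CWF n h → Set
IsCWF n h f =
  (∀ m → f m 0 ≡ 0) ×
  (∀ m l → 1 ≤ l → l ≤ n → (f m l ≡ f m (l ∸ 1)) ⊎ (f m l ≡ suc (f m (l ∸ 1)))) ×
  -- (c): for j ∈ [h], paper indices 2j-1, 2j are 0-based 2(j-1), 2(j-1)+1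
  (∀ (j : ℕ) (m₁ m₂ : Fin (2 * h)) → toℕ m₁ ≡ 2 * j → toℕ m₂ ≡ suc (2 * j) →
     ∃ λ w → ∀ l → l ≤ n → f m₁ l + f m₂ (n ∸ l) ≡ w)

Mf : ∀ n h → CWF n h → List (ℕ × ℕ)
Mf n h f = concatMap (λ m → map (λ l → (l ∸ f m l , f m l)) (range n)) (allFin (2 * h))

IsSolution : ∀ n h → CWF n h → List (ℕ × ℕ) → Set
IsSolution n h f M = M ↭ Mf n h f

InD : ∀ n h → CWF n h → Fin (2 * h) → Fin (2 * h) → ℕ → Set
InD n h f m₁ m₂ l = (1 ≤ l) × (l ≤ n) × (f m₁ l ≢ f m₂ l)

MaxInterval : ∀ n h → CWF n h → Fin (2 * h) → Fin (2 * h) → ℕ → ℕ → Set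
MaxInterval n h f m₁ m₂ k₁ k₂ =
  (1 ≤ k₁) × (k₁ ≤ k₂) × (k₂ ≤ n) ×
  (∀ l → k₁ ≤ l → l ≤ k₂ → InD n h f m₁ m₂ l) ×
  ¬ InD n h f m₁ m₂ (k₁ ∸ 1) × ¬ InD n h f m₁ m₂ (suc k₂)

AtMostOneMaxInterval : ∀ n h → CWF n h → Fin (2 * h) → Fin (2 * h) → Set
AtMostOneMaxInterval n h f m₁ m₂ =
  ∀ a b c d → MaxInterval n h f m₁ m₂ a b → MaxInterval n h f m₁ m₂ c d →
    (a ≡ c) × (b ≡ d)

AtMostTwoMaxIntervals : ∀ n h → CWF n h → Fin (2 * h) → Fin (2 * h) → Set
AtMostTwoMaxIntervals n h f m₁ m₂ =
  ∀ a₁ b₁ a₂ b₂ a₃ b₃ →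
    MaxInterval n h f m₁ m₂ a₁ b₁ → MaxInterval n h f m₁ m₂ a₂ b₂ → MaxInterval n h f m₁ m₂ a₃ b₃ →
    ((a₁ ≡ a₂) × (b₁ ≡ b₂)) ⊎ ((a₁ ≡ a₃) × (b₁ ≡ b₃)) ⊎ ((a₂ ≡ a₃) × (b₂ ≡ b₃))

C1 : ∀ n h → CWF n h → Set
C1 n h f = ∀ m₁ m₂ → toℕ m₂ ≡ star (toℕ m₁) → AtMostTwoMaxIntervals n h f m₁ m₂

C2 : ∀ n h → CWF n h → Set
C2 n h f = ∀ m₁ m₂ → toℕ m₂ ≢ star (toℕ m₁) → AtMostOneMaxInterval n h f m₁ m₂

-- Median and A(w̄/2):  med(f_m) = w̄/2  ⇔  f_m(⌊n/2⌋) + f_m(⌈n/2⌉) = w̄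

InAHalf : ∀ n h → CWF n h → ℕ → Fin (2 * h) → Set
InAHalf n h f wbar m = f m ⌊ n /2⌋ + f m ⌈ n /2⌉ ≡ wbar

bCount : ∀ n h → CWF n h → ℕ → ℕ → ℕ
bCount n h f l zero    = length (filter (λ m → f m l ≟ 0) (allFin (2 * h)))
bCount n h f l (suc v) =
  length (filter (λ m → (f m l ≟ suc v) ×-dec (f m (l ∸ 1) ≟ suc v)) (allFin (2 * h)))

cCount : ∀ n h → CWF n h → ℕ → ℕ → ℕ
cCount n h f l zero = 0
cCount n h f l (suc v) =
  length (filter (λ m → (f m l ≟ suc v) ×-dec (f m (l ∸ 1) ≟ v)) (allFin (2 * h)))

IsBranchingPoint : ∀ n h → CWF n h → ℕ → ℕ → Set
IsBranchingPoint n h f l w = (0 < bCount n h f l w) × (0 < cCount n h f l w)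

{-# OPTIONS --safe #-}
module Submission where

-- Suppose (l, w) with w = f_m(l) and l ≤ ⌊n/2⌋ were a branching point. As f_m(l-1) is w or
-- w-1, one of its two witnesses m₂ agrees with f_m at l but not at l-1. All f_k end at
-- f_k(n) = w̄, because the only pairs of M(H) on the line a + x = n come from whole strings;
-- so by (c) the partner m* of m has the same median values as m, and m₂ is neither in
-- A(w̄/2) (it would coincide with f_m) nor m*. Being outside A(w̄/2), f_{m₂} differs from
-- f_m at ⌊n/2⌋ or ⌈n/2⌉, a point q ≥ l. Thus l-1 and q lie in D(m, m₂) but l does not,
-- giving two maximal intervals against (C2).

open import Defs
open import Data.Nat using (ℕ; zero; suc; _+_; _*_; _∸_; _≤_; _<_; z≤n; s≤s; ⌊_/2⌋; ⌈_/2⌉; _≤?_)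
open import Data.Nat.Properties
open import Data.Bool using (Bool; true; false)
open import Data.Fin using (Fin; toℕ)
open import Data.Vec using (Vec; toList)
open import Data.List using (List; []; _∷_; map; take; drop; length; filter; allFin)
open import Data.List.Properties using (length-take; take-all; length-drop)
open import Data.Vec.Properties using (length-toList)
open import Data.List.Relation.Unary.Any using (Any; here; there; satisfied)
open import Data.List.Membership.Propositional using (_∈_; lose)
open import Data.List.Membership.Propositional.Properties
  using (∈-map⁺; ∈-map⁻; ∈-++⁻; ∈-concatMap⁺; ∈-concatMap⁻; ∈-upTo⁺; ∈-upTo⁻; ∈-allFin)
open import Data.List.Relation.Binary.Permutation.Propositional using (↭-sym)
open import Data.List.Relation.Binary.Permutation.Propositional.Properties using (∈-resp-↭)
open import Data.Product using (_×_; _,_; ∃; ∃₂; proj₁; proj₂)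
open import Data.Sum using (_⊎_; inj₁; inj₂)
open import Data.Empty using (⊥-elim)
open import Relation.Nullary using (¬_; yes; no)
open import Relation.Nullary.Decidable using (_×-dec_; ¬?)
open import Relation.Unary using (Decidable)
open import Relation.Binary.PropositionalEquality
open ≡-Reasoning

filter-some⁻ : ∀ {A : Set} {P : A → Set} (P? : Decidable P) xs →
               0 < length (filter P? xs) → Any P xs
filter-some⁻ P? (x ∷ xs) pos with P? x
... | yes px = here px
... | no _   = there (filter-some⁻ P? xs pos)

∈-range⁻ : ∀ {n j} → j ∈ range n → j ≤ n
∈-range⁻ j∈ with ∈-map⁻ suc j∈
... | _ , k∈ , refl = ∈-upTo⁻ k∈

n∈range : ∀ {n} → 1 ≤ n → n ∈ range n
n∈range {suc n} _ = ∈-map⁺ suc (∈-upTo⁺ ≤-refl)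

-- Both halves of Mstr t, and the block of Mf belonging to f m, are profiles definitionally.
profile : (ℕ → ℕ) → ℕ → List (ℕ × ℕ)
profile g n = map (λ j → (j ∸ g j , g j)) (range n)

∈-profile-diagonal : ∀ {g n a x} → (∀ j → j ≤ n → g j ≤ j) →
                     (a , x) ∈ profile g n → a + x ≡ n → x ≡ g n
∈-profile-diagonal {g} g≤ ax∈ a+x≡n with ∈-map⁻ (λ j → (j ∸ g j , g j)) ax∈
... | j , j∈ , refl = cong g (trans (sym (m∸n+n≡m (g≤ j (∈-range⁻ j∈)))) a+x≡n)

diagonal∈profile : ∀ g {n} → 1 ≤ n → (n ∸ g n , g n) ∈ profile g n
diagonal∈profile g 1≤n = ∈-map⁺ (λ j → (j ∸ g j , g j)) (n∈range 1≤n)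

wtL≤length : ∀ bs → wtL bs ≤ length bs
wtL≤length []           = z≤n
wtL≤length (true  ∷ bs) = s≤s (wtL≤length bs)
wtL≤length (false ∷ bs) = m≤n⇒m≤1+n (wtL≤length bs)

wtPre≤ : ∀ {n} (t : Vec Bool n) j → wtPre t j ≤ j
wtPre≤ t j = ≤-trans (wtL≤length (take j (toList t)))
                     (≤-trans (≤-reflexive (length-take j (toList t))) (m⊓n≤m j _))

wtSuf≤ : ∀ {n} (t : Vec Bool n) j → j ≤ n → wtSuf t j ≤ j
wtSuf≤ {n} t j j≤n = ≤-trans (wtL≤length (drop (n ∸ j) (toList t))) (≤-reflexive length≡j)
  where
  length≡j : length (drop (n ∸ j) (toList t)) ≡ j
  length≡j = begin
    length (drop (n ∸ j) (toList t)) ≡⟨ length-drop (n ∸ j) (toList t) ⟩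
    length (toList t) ∸ (n ∸ j)      ≡⟨ cong (_∸ (n ∸ j)) (length-toList t) ⟩
    n ∸ (n ∸ j)                      ≡⟨ m∸[m∸n]≡n j≤n ⟩
    j                                ∎

wtPre-all : ∀ {n} (t : Vec Bool n) → wtPre t n ≡ wt t
wtPre-all {n} t = cong wtL (take-all n (toList t) (≤-reflexive (length-toList t)))

wtSuf-all : ∀ {n} (t : Vec Bool n) → wtSuf t n ≡ wt t
wtSuf-all {n} t = cong (λ k → wtL (drop k (toList t))) (n∸n≡0 n)

∈Mstr-diagonal : ∀ {n a x} (t : Vec Bool n) → (a , x) ∈ Mstr t → a + x ≡ n → x ≡ wt t
∈Mstr-diagonal {n} t ax∈ a+x≡n with ∈-++⁻ (profile (wtPre t) n) ax∈
... | inj₁ ∈pre = trans (∈-profile-diagonal (λ j _ → wtPre≤ t j) ∈pre a+x≡n) (wtPre-all t)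
... | inj₂ ∈suf = trans (∈-profile-diagonal (wtSuf≤ t) ∈suf a+x≡n) (wtSuf-all t)

∈MH-diagonal : ∀ {n h wbar a x} (H : Fin h → Vec Bool n) → (∀ i → wt (H i) ≡ wbar) →
               (a , x) ∈ MH H → a + x ≡ n → x ≡ wbar
∈MH-diagonal {h = h} H wH ax∈ a+x≡n
  with i , ax∈Hi ← satisfied (∈-concatMap⁻ (λ i → Mstr (H i)) {xs = allFin h} ax∈)
  = trans (∈Mstr-diagonal (H i) ax∈Hi a+x≡n) (wH i)

cwf-≤ : ∀ {n h} {f : CWF n h} → IsCWF n h f → ∀ m l → l ≤ n → f m l ≤ l
cwf-≤ (f0 , _ , _) m zero _ = ≤-reflexive (f0 m)
cwf-≤ {n} {h} {f} cw@(_ , step , _) m (suc l) l<n with step m (suc l) (s≤s z≤n) l<n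
... | inj₁ eq = ≤-trans (≤-reflexive eq) (m≤n⇒m≤1+n (cwf-≤ {n} {h} {f} cw m l (<⇒≤ l<n)))
... | inj₂ eq = ≤-trans (≤-reflexive eq) (s≤s (cwf-≤ {n} {h} {f} cw m l (<⇒≤ l<n)))

solution-endpoint : ∀ {n h wbar} {f : CWF n h} (H : Fin h → Vec Bool n) → 1 ≤ n →
               (∀ i → wt (H i) ≡ wbar) → IsCWF n h f → IsSolution n h f (MH H) →
               ∀ m → f m n ≡ wbar
solution-endpoint {n} {h} {f = f} H 1≤n wH cw sol m =
  ∈MH-diagonal H wH (∈-resp-↭ (↭-sym sol) end∈Mf) (m∸n+n≡m (cwf-≤ {n} {h} {f} cw m n ≤-refl))
  where
  end∈Mf : (n ∸ f m n , f m n) ∈ Mf n h f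
  end∈Mf = ∈-concatMap⁺ (λ k → profile (f k) n) (lose (∈-allFin m) (diagonal∈profile (f m) 1≤n))

star-cases : ∀ k → (∃ λ j → k ≡ 2 * j × star k ≡ suc (2 * j)) ⊎
                   (∃ λ j → k ≡ suc (2 * j) × star k ≡ 2 * j)
star-cases zero          = inj₁ (0 , refl , refl)
star-cases (suc zero)    = inj₂ (0 , refl , refl)
star-cases (suc (suc k)) with star-cases k
... | inj₁ (j , k≡ , k*≡) =
  inj₁ (suc j , trans (cong (2 +_) k≡) (sym (*-suc 2 j)) ,
                trans (cong (2 +_) k*≡) (cong suc (sym (*-suc 2 j))))
... | inj₂ (j , k≡ , k*≡) =
  inj₂ (suc j , trans (cong (2 +_) k≡) (cong suc (sym (*-suc 2 j))) ,
                trans (cong (2 +_) k*≡) (sym (*-suc 2 j)))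

complement-sum : ∀ {n w} (g g' : ℕ → ℕ) → (∀ l → l ≤ n → g l + g' (n ∸ l) ≡ w) →
                 ∀ {l l'} → l + l' ≡ n → g l + g' l' ≡ w
complement-sum g g' sum {l} {l'} refl =
  subst (λ k → g l + g' k ≡ _) (m+n∸m≡n l l') (sum l (m≤m+n l l'))

cwf-complement : ∀ {n h} {f : CWF n h} → IsCWF n h f → ∀ {m m'} → toℕ m' ≡ star (toℕ m) →
                 ∀ {l l'} → l + l' ≡ n → f m l + f m' l' ≡ f m n
cwf-complement {n} {f = f} (f0 , _ , pairs) {m} {m'} m'≡m* {l} {l'} l+l'≡n
  with star-cases (toℕ m)
... | inj₁ (j , m≡ , m*≡) with w , sum ← pairs j m m' m≡ (trans m'≡m* m*≡) = begin
  f m l + f m' l' ≡⟨ complement-sum (f m) (f m') sum l+l'≡n ⟩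
  w               ≡⟨ complement-sum (f m) (f m') sum (+-identityʳ n) ⟨
  f m n + f m' 0  ≡⟨ cong (f m n +_) (f0 m') ⟩
  f m n + 0       ≡⟨ +-identityʳ (f m n) ⟩
  f m n           ∎
... | inj₂ (j , m≡ , m*≡) with w , sum ← pairs j m' m (trans m'≡m* m*≡) m≡ = begin
  f m l + f m' l' ≡⟨ +-comm (f m l) (f m' l') ⟩
  f m' l' + f m l ≡⟨ complement-sum (f m') (f m) sum (trans (+-comm l' l) l+l'≡n) ⟩
  w               ≡⟨ complement-sum (f m') (f m) sum refl ⟨
  f m' 0 + f m n  ≡⟨ cong (_+ f m n) (f0 m') ⟩
  f m n           ∎

InAHalf-star : ∀ {n h wbar} {f : CWF n h} → IsCWF n h f → ∀ {m m'} →
               toℕ m' ≡ star (toℕ m) → f m n ≡ wbar →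
               InAHalf n h f wbar m → InAHalf n h f wbar m'
InAHalf-star {n} {h} {wbar} {f} cw {m} {m'} m'≡m* end mA =
  trans (cong₂ _+_ same-at-⌊n/2⌋ same-at-⌈n/2⌉) mA
  where
  complement : ∀ {l l'} → l + l' ≡ n → f m l + f m' l' ≡ wbar
  complement l+l'≡n = trans (cwf-complement {n} {h} {f} cw m'≡m* l+l'≡n) end
  same-at-⌊n/2⌋ : f m' ⌊ n /2⌋ ≡ f m ⌊ n /2⌋
  same-at-⌊n/2⌋ = +-cancelˡ-≡ (f m ⌈ n /2⌉) _ _ (begin
    f m ⌈ n /2⌉ + f m' ⌊ n /2⌋ ≡⟨ complement (trans (+-comm ⌈ n /2⌉ ⌊ n /2⌋) (⌊n/2⌋+⌈n/2⌉≡n n)) ⟩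
    wbar                       ≡⟨ mA ⟨
    f m ⌊ n /2⌋ + f m ⌈ n /2⌉  ≡⟨ +-comm (f m ⌊ n /2⌋) (f m ⌈ n /2⌉) ⟩
    f m ⌈ n /2⌉ + f m ⌊ n /2⌋  ∎)
  same-at-⌈n/2⌉ : f m' ⌈ n /2⌉ ≡ f m ⌈ n /2⌉
  same-at-⌈n/2⌉ = +-cancelˡ-≡ (f m ⌊ n /2⌋) _ _ (trans (complement (⌊n/2⌋+⌈n/2⌉≡n n)) (sym mA))

HoldsOn : (ℕ → Set) → ℕ → ℕ → Set
HoldsOn P a b = ∀ l → a ≤ l → l ≤ b → P l

module _ {P : ℕ → Set} where

  holdsOn-point : ∀ {p} → P p → HoldsOn P p p
  holdsOn-point Pp l p≤l l≤p = subst P (≤-antisym p≤l l≤p) Pp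

  holdsOn-join : ∀ {a b c d} → HoldsOn P a b → HoldsOn P c d → c ≤ suc b → HoldsOn P a d
  holdsOn-join {b = b} onab oncd c≤1+b l a≤l l≤d with l ≤? b
  ... | yes l≤b = onab l a≤l l≤b
  ... | no  l≰b = oncd l (≤-trans c≤1+b (≰⇒> l≰b)) l≤d

  module _ (P? : Decidable P) where

    extendLeft : ¬ P 0 → ∀ p → P p → ∃ λ a → a ≤ p × HoldsOn P a p × ¬ P (a ∸ 1)
    extendLeft ¬P0 zero    P0  = ⊥-elim (¬P0 P0)
    extendLeft ¬P0 (suc p) P1+p with P? p
    ... | no ¬Pp = suc p , ≤-refl , holdsOn-point P1+p , ¬Pp
    ... | yes Pp with a , a≤p , on , ¬Pa-1 ← extendLeft ¬P0 p Pp =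
      a , m≤n⇒m≤1+n a≤p , holdsOn-join on (holdsOn-point P1+p) ≤-refl , ¬Pa-1

    extendRight : ∀ {n} → (∀ l → P l → l ≤ n) → ∀ d p → n ≤ d + p → P p →
                  ∃ λ b → p ≤ b × HoldsOn P p b × ¬ P (suc b)
    extendRight bound zero p n≤p Pp =
      p , ≤-refl , holdsOn-point Pp , λ P1+p → 1+n≰n (≤-trans (bound (suc p) P1+p) n≤p)
    extendRight {n} bound (suc d) p n≤ Pp with P? (suc p)
    ... | no ¬P1+p = p , ≤-refl , holdsOn-point Pp , ¬P1+p
    ... | yes P1+p
      with b , p<b , on , ¬P1+b ← extendRight bound d (suc p) (subst (n ≤_) (sym (+-suc d p)) n≤) P1+p =
      b , <⇒≤ p<b , holdsOn-join (holdsOn-point Pp) on ≤-refl , ¬P1+b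

    maximalRun : ∀ {n} → ¬ P 0 → (∀ l → P l → l ≤ n) → ∀ p → P p →
                 ∃₂ λ a b → a ≤ p × p ≤ b × HoldsOn P a b × ¬ P (a ∸ 1) × ¬ P (suc b)
    maximalRun {n} ¬P0 bound p Pp
      with a , a≤p , onL , ¬Pa-1 ← extendLeft ¬P0 p Pp
         | b , p≤b , onR , ¬P1+b ← extendRight bound n p (m≤m+n n p) Pp =
      a , b , a≤p , p≤b , holdsOn-join onL onR (n≤1+n p) , ¬Pa-1 , ¬P1+b

module _ (n h : ℕ) (f : CWF n h) (m₁ m₂ : Fin (2 * h)) where

  InD? : Decidable (InD n h f m₁ m₂)
  InD? l = (1 ≤? l) ×-dec ((l ≤? n) ×-dec ¬? (f m₁ l ≟ f m₂ l))

  InD⇒maxInterval : ∀ {p} → InD n h f m₁ m₂ p →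
                    ∃₂ λ a b → a ≤ p × p ≤ b × MaxInterval n h f m₁ m₂ a b
  InD⇒maxInterval {p} p∈D
    with a , b , a≤p , p≤b , on , ¬a-1∈D , ¬b+1∈D ←
           maximalRun InD? (λ ()) (λ _ (_ , l≤n , _) → l≤n) p p∈D
    = a , b , a≤p , p≤b , maxInterval (≤-trans a≤p p≤b) on ¬a-1∈D ¬b+1∈D
    where
    maxInterval : ∀ {a b} → a ≤ b → HoldsOn (InD n h f m₁ m₂) a b →
                  ¬ InD n h f m₁ m₂ (a ∸ 1) → ¬ InD n h f m₁ m₂ (suc b) → MaxInterval n h f m₁ m₂ a b
    maxInterval {a} {b} a≤b on ¬a-1∈D ¬b+1∈D =
      proj₁ (on a ≤-refl a≤b) , a≤b , proj₁ (proj₂ (on b a≤b ≤-refl)) , on , ¬a-1∈D , ¬b+1∈D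

  AtMostOneMaxInterval⇒InD-convex : AtMostOneMaxInterval n h f m₁ m₂ →
                                    ∀ {i j k} → InD n h f m₁ m₂ i → InD n h f m₁ m₂ k →
                                    i ≤ j → j ≤ k → InD n h f m₁ m₂ j
  AtMostOneMaxInterval⇒InD-convex unique {i} {j} {k} i∈D k∈D i≤j j≤k
    with a₁ , b₁ , a₁≤i , _ , I₁@(_ , _ , _ , on₁ , _) ← InD⇒maxInterval i∈D
       | a₂ , b₂ , _ , k≤b₂ , I₂ ← InD⇒maxInterval k∈D
    with refl , refl ← unique a₁ b₁ a₂ b₂ I₁ I₂
    = on₁ j (≤-trans a₁≤i i≤j) (≤-trans j≤k k≤b₂)

MergeAt : ∀ n h → CWF n h → Fin (2 * h) → Fin (2 * h) → ℕ → Set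
MergeAt n h f m m₂ l = f m l ≡ f m₂ l × f m (l ∸ 1) ≢ f m₂ (l ∸ 1)

branching⇒mergeAt : ∀ n h (f : CWF n h) m l → IsBranchingPoint n h f l (f m l) →
                    ∃ λ m₂ → MergeAt n h f m m₂ l
branching⇒mergeAt n h f m l branching with f m l | branching
... | zero  | _ , ()
... | suc v | b>0 , c>0
  with m' , fm'l≡ , fm'l-1≡ ← satisfied (filter-some⁻ (λ k → (f k l ≟ suc v) ×-dec (f k (l ∸ 1) ≟ suc v))
                                                       (allFin (2 * h)) b>0)
     | m'' , fm''l≡ , fm''l-1≡ ← satisfied (filter-some⁻ (λ k → (f k l ≟ suc v) ×-dec (f k (l ∸ 1) ≟ v))
                                                          (allFin (2 * h)) c>0)
  with f m (l ∸ 1) ≟ suc v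
... | yes fml-1≡ = m'' , sym fm''l≡ , λ e → 1+n≢n (trans (sym fml-1≡) (trans e fm''l-1≡))
... | no  fml-1≢ = m' , sym fm'l≡ , λ e → fml-1≢ (trans e fm'l-1≡)

AgreeOnA : ∀ n h → CWF n h → ℕ → Set
AgreeOnA n h f wbar =
  ∀ m₁ m₂ → InAHalf n h f wbar m₁ → InAHalf n h f wbar m₂ → ∀ l → l ≤ n → f m₁ l ≡ f m₂ l

¬mergeAt-≤⌊n/2⌋ : ∀ {n h wbar} {f : CWF n h} → IsCWF n h f → (∀ m → f m n ≡ wbar) →
                  C2 n h f → AgreeOnA n h f wbar →
                  ∀ {m m₂ l} → InAHalf n h f wbar m → l ≤ ⌊ n /2⌋ → ¬ MergeAt n h f m m₂ l
¬mergeAt-≤⌊n/2⌋ {n} {h} {wbar} {f} cw@(f0 , _) end c2 agree {m} {m₂} {l} mA l≤⌊n/2⌋ (meet , split) =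
  proj₂ (proj₂ l∈D) meet
  where
  l-1≤l : l ∸ 1 ≤ l
  l-1≤l = m∸n≤m l 1
  l≤n : l ≤ n
  l≤n = ≤-trans l≤⌊n/2⌋ (⌊n/2⌋≤n n)
  m₂∉A : ¬ InAHalf n h f wbar m₂
  m₂∉A m₂A = split (agree m m₂ mA m₂A (l ∸ 1) (≤-trans l-1≤l l≤n))
  m₂≢m* : toℕ m₂ ≢ star (toℕ m)
  m₂≢m* m₂≡m* = m₂∉A (InAHalf-star {n} {h} {wbar} {f} cw m₂≡m* (end m) mA)
  1≤l-1 : 1 ≤ l ∸ 1
  1≤l-1 = n≢0⇒n>0 λ l-1≡0 →
    subst (λ k → f m k ≢ f m₂ k) l-1≡0 split (trans (f0 m) (sym (f0 m₂)))
  l-1∈D : InD n h f m m₂ (l ∸ 1)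
  l-1∈D = 1≤l-1 , ≤-trans l-1≤l l≤n , split
  split-at-median : ∃ λ q → l ≤ q × q ≤ n × f m q ≢ f m₂ q
  split-at-median with f m ⌊ n /2⌋ ≟ f m₂ ⌊ n /2⌋
  ... | no  ≢⌊n/2⌋ = ⌊ n /2⌋ , l≤⌊n/2⌋ , ⌊n/2⌋≤n n , ≢⌊n/2⌋
  ... | yes ≡⌊n/2⌋ = ⌈ n /2⌉ , ≤-trans l≤⌊n/2⌋ (⌊n/2⌋≤⌈n/2⌉ n) , ⌈n/2⌉≤n n ,
                     λ ≡⌈n/2⌉ → m₂∉A (trans (cong₂ _+_ (sym ≡⌊n/2⌋) (sym ≡⌈n/2⌉)) mA)
  l∈D : InD n h f m m₂ l
  l∈D with q , l≤q , q≤n , ≢q ← split-at-median =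
    AtMostOneMaxInterval⇒InD-convex n h f m m₂ (c2 m m₂ m₂≢m*)
      l-1∈D (≤-trans 1≤l-1 (≤-trans l-1≤l l≤q) , q≤n , ≢q) l-1≤l l≤q

lemma4 : (n h wbar : ℕ) → 1 ≤ n → 1 ≤ h → wbar ≤ n →
    (H : Fin h → Vec Bool n) → (∀ i → wt (H i) ≡ wbar) →
    (f : CWF n h) → IsCWF n h f → IsSolution n h f (MH H) → C1 n h f → C2 n h f →
    (∀ m₁ m₂ → InAHalf n h f wbar m₁ → InAHalf n h f wbar m₂ → ∀ l → l ≤ n → f m₁ l ≡ f m₂ l) →
    ∀ m → InAHalf n h f wbar m → ∀ l → 1 ≤ l → l ≤ ⌊ n /2⌋ → ¬ IsBranchingPoint n h f l (f m l)
lemma4 n h wbar 1≤n _ _ H wH f cw sol _ c2 agree m mA l _ l≤⌊n/2⌋ branching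
  with m₂ , merge ← branching⇒mergeAt n h f m l branching
  = ¬mergeAt-≤⌊n/2⌋ {n} {h} {wbar} {f} cw (solution-endpoint {f = f} H 1≤n wH cw sol)
                    c2 agree mA l≤⌊n/2⌋ merge
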